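{- Let $G$ be a graph without a universal vertex and let $X=(K^1,K^2)$ be a $(0,2)$-partition of $G$. If $G$ has a $(0,2)$-partition $X'=(K^{1'},K^{2'})$ distinct from $X$, then $H_X\simeq H_{X'}\simeq G$.
   Context: All graphs are finite and simple. A $(0,2)$-partition of $G$ is a partition $(K^1,K^2)$ of $V(G)$ into two cliques. Given such a partition $X=(K^1,K^2)$, a transversal edge is an edge with one endpoint in $K^1$ and the other in $K^2$; the transversal subgraph $H_X$ of $G$ with respect to $X$ is the subgraph of $G$ induced by the set of vertices incident to at least one transversal edge. -}

module Defs where

open import Data.Nat using (ℕ)
open import Data.Fin using (Fin)
open import Data.Bool using (Bool; true; false; not; _∧_; _xor_; T)
open import Data.List using (allFin)
open import Data.Bool.ListAction using (any)
open import Data.Sum using (_⊎_)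
open import Data.Product using (Σ; ∃; _×_; proj₁; _,_)
open import Relation.Binary.PropositionalEquality using (_≡_; _≢_)
open import Relation.Nullary using (¬_)
open import Function.Bundles using (_↔_; Inverse)

record Graph (n : ℕ) : Set where
  field
    adj    : Fin n → Fin n → Bool
    sym    : ∀ u v → adj u v ≡ adj v u
    irrefl : ∀ v → adj v v ≡ false
open Graph public

-- A general (vertex type, adjacency) structure, used to compare a graph with
-- an induced subgraph up to isomorphism.
record SGraph : Set₁ where
  field
    V   : Set
    Adj : V → V → Bool
open SGraph public

asSGraph : ∀ {n} → Graph n → SGraph
asSGraph {n} G = record { V = Fin n ; Adj = adj G }

_≃G_ : SGraph → SGraph → Set
A ≃G B = Σ (V A ↔ V B) λ f →
  ∀ u v → Adj A u v ≡ Adj B (Inverse.to f u) (Inverse.to f v)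

induced : ∀ {n} → Graph n → (Fin n → Bool) → SGraph
induced {n} G S = record
  { V = Σ (Fin n) (λ v → T (S v))
  ; Adj = λ u v → adj G (proj₁ u) (proj₁ v) }

HasUniversalVertex : ∀ {n} → Graph n → Set
HasUniversalVertex {n} G = ∃ λ v → ∀ u → u ≢ v → adj G v u ≡ true

-- An ordered bipartition (K¹, K²) of V(G), encoded by side : Fin n → Bool
-- (side v ≡ false means v ∈ K¹, side v ≡ true means v ∈ K²).
-- It is a (0,2)-partition if both parts are cliques.
Is02Partition : ∀ {n} → Graph n → (Fin n → Bool) → Set
Is02Partition {n} G side =
  ∀ u v → u ≢ v → side u ≡ side v → adj G u v ≡ true

SamePartition : ∀ {n} → (Fin n → Bool) → (Fin n → Bool) → Set
SamePartition s s' = (∀ v → s v ≡ s' v) ⊎ (∀ v → s v ≡ not (s' v))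

inTransversal : ∀ {n} → Graph n → (Fin n → Bool) → Fin n → Bool
inTransversal {n} G side v = any (λ u → adj G v u ∧ (side u xor side v)) (allFin n)

H : ∀ {n} → Graph n → (Fin n → Bool) → SGraph
H G side = induced G (inTransversal G side)

{-# OPTIONS --safe #-}
module Submission where

-- If some vertex v had no transversal edge for X, all its neighbours would lie in its own
-- X-class, so its X'-class is contained in its X-class. A vertex w of v's X-class outside
-- v's X'-class would then be universal: it sees its X-class and its X'-class, and every
-- other vertex is in one of them. Hence the two classes of v coincide and X' = X. So for
-- distinct partitions every vertex is in H_X (and symmetrically in H_X'), and both
-- transversal subgraphs are G itself.

open import Defs hiding (sym)
open import Data.Fin using (Fin; _≟_)
open import Data.Bool using (Bool; true; false; not; _∧_; _xor_; T)
import Data.Bool as Bool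
open import Data.Bool.Properties using (¬-not; not-involutive; T-irrelevant)
open import Data.List.Membership.Propositional using (lose)
open import Data.List.Membership.Propositional.Properties using (∈-allFin)
open import Data.List.Relation.Unary.Any.Properties using (any⁺)
open import Data.Product using (_×_; _,_; proj₁)
open import Data.Sum using (inj₁; inj₂)
open import Data.Unit using (tt)
open import Function using (_∘_; case_of_)
open import Function.Bundles using (mk↔ₛ′)
open import Relation.Nullary using (¬_; yes; no)
open import Relation.Nullary.Decidable using (T?; decidable-stable)
open import Relation.Binary.PropositionalEquality

≢⇒xor≡true : ∀ {a b : Bool} → a ≢ b → a xor b ≡ true
≢⇒xor≡true {false} {false} a≢b = case a≢b refl of λ ()
≢⇒xor≡true {false} {true}  _   = refl
≢⇒xor≡true {true}  {false} _   = refl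
≢⇒xor≡true {true}  {true}  a≢b = case a≢b refl of λ ()

≡-class⇒≡ : ∀ {a b c : Bool} → (a ≡ c → b ≡ c) → (b ≡ c → a ≡ c) → a ≡ b
≡-class⇒≡ {false} {false}         _ _ = refl
≡-class⇒≡ {true}  {true}          _ _ = refl
≡-class⇒≡ {false} {true} {false}  f _ = case f refl of λ ()
≡-class⇒≡ {false} {true} {true}   _ g = case g refl of λ ()
≡-class⇒≡ {true}  {false} {false} _ g = case g refl of λ ()
≡-class⇒≡ {true}  {false} {true}  f _ = case f refl of λ ()

≡-class⇒≡not : ∀ {a b c : Bool} → (a ≡ c → b ≡ not c) → (b ≡ not c → a ≡ c) → a ≡ not b
≡-class⇒≡not {false} {true}         _ _ = refl
≡-class⇒≡not {true}  {false}        _ _ = refl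
≡-class⇒≡not {false} {false} {false} f _ = case f refl of λ ()
≡-class⇒≡not {false} {false} {true}  _ g = case g refl of λ ()
≡-class⇒≡not {true}  {true}  {false} _ g = case g refl of λ ()
≡-class⇒≡not {true}  {true}  {true}  f _ = case f refl of λ ()

classes⇒SamePartition : ∀ {n} {X X' : Fin n → Bool} v →
  (∀ w → X w ≡ X v → X' w ≡ X' v) → (∀ w → X' w ≡ X' v → X w ≡ X v) →
  SamePartition X X'
classes⇒SamePartition {X = X} {X'} v fwd bwd with X v | X' v
... | false | false = inj₁ λ w → ≡-class⇒≡ (fwd w) (bwd w)
... | true  | true  = inj₁ λ w → ≡-class⇒≡ (fwd w) (bwd w)
... | false | true  = inj₂ λ w → ≡-class⇒≡not (fwd w) (bwd w)
... | true  | false = inj₂ λ w → ≡-class⇒≡not (fwd w) (bwd w)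

transversalEdge⇒inTransversal : ∀ {n} (G : Graph n) (X : Fin n → Bool) {u v} →
  adj G v u ≡ true → X u ≢ X v → T (inTransversal G X v)
transversalEdge⇒inTransversal G X {u} vu Xu≢Xv =
  any⁺ _ (lose (∈-allFin u) (subst T (sym (cong₂ _∧_ vu (≢⇒xor≡true Xu≢Xv))) tt))

module _ {n} {G : Graph n} {X X' : Fin n → Bool}
  (noUniversal : ¬ HasUniversalVertex G) (isX : Is02Partition G X) (isX' : Is02Partition G X')
  where

  noTransversalEdge⇒SamePartition : ∀ v →
    (∀ u → X u ≢ X v → adj G v u ≡ false) → SamePartition X X'
  noTransversalEdge⇒SamePartition v noEdge = classes⇒SamePartition v fwd bwd
    where
    neighbour⇒sameSide : ∀ {w} → adj G v w ≡ true → X w ≡ X v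
    neighbour⇒sameSide {w} vw =
      decidable-stable (X w Bool.≟ X v) λ Xw≢Xv → case trans (sym vw) (noEdge w Xw≢Xv) of λ ()

    bwd : ∀ w → X' w ≡ X' v → X w ≡ X v
    bwd w X'w≡X'v with w ≟ v
    ... | yes refl = refl
    ... | no  w≢v  = neighbour⇒sameSide (isX' v w (w≢v ∘ sym) (sym X'w≡X'v))

    fwd : ∀ w → X w ≡ X v → X' w ≡ X' v
    fwd w Xw≡Xv = decidable-stable (X' w Bool.≟ X' v) λ X'w≢X'v → noUniversal (w , universal X'w≢X'v)
      where
      universal : X' w ≢ X' v → ∀ u → u ≢ w → adj G w u ≡ true
      universal X'w≢X'v u u≢w with X' u Bool.≟ X' v
      ... | yes X'u≡X'v = isX w u (u≢w ∘ sym) (trans Xw≡Xv (sym (bwd u X'u≡X'v)))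
      ... | no  X'u≢X'v = isX' w u (u≢w ∘ sym) (trans (¬-not X'w≢X'v) (sym (¬-not X'u≢X'v)))

  inTransversal-total : ¬ SamePartition X X' → ∀ v → T (inTransversal G X v)
  inTransversal-total distinct v = decidable-stable (T? _) λ v∉H →
    distinct (noTransversalEdge⇒SamePartition v λ u Xu≢Xv →
      ¬-not λ vu → v∉H (transversalEdge⇒inTransversal G X vu Xu≢Xv))

SamePartition-sym : ∀ {n} {X X' : Fin n → Bool} → SamePartition X X' → SamePartition X' X
SamePartition-sym (inj₁ X≡X') = inj₁ (sym ∘ X≡X')
SamePartition-sym (inj₂ X≡notX') = inj₂ λ v → trans (sym (not-involutive _)) (cong not (sym (X≡notX' v)))

induced-cong : ∀ {n} (G : Graph n) {S S' : Fin n → Bool} →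
  (∀ v → T (S v) → T (S' v)) → (∀ v → T (S' v) → T (S v)) → induced G S ≃G induced G S'
induced-cong G S⊆S' S'⊆S =
  mk↔ₛ′ (λ (v , p) → v , S⊆S' v p) (λ (v , p) → v , S'⊆S v p)
        (λ (v , p) → cong (v ,_) (T-irrelevant _ p)) (λ (v , p) → cong (v ,_) (T-irrelevant _ p))
  , λ _ _ → refl

induced-full : ∀ {n} (G : Graph n) {S : Fin n → Bool} → (∀ v → T (S v)) → induced G S ≃G asSGraph G
induced-full G full =
  mk↔ₛ′ proj₁ (λ v → v , full v) (λ _ → refl) (λ (v , p) → cong (v ,_) (T-irrelevant _ p))
  , λ _ _ → refl

lemma8 : ∀ {n} (G : Graph n) (X X' : Fin n → Bool) →
    ¬ HasUniversalVertex G →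
    Is02Partition G X → Is02Partition G X' →
    ¬ SamePartition X X' →
    (H G X ≃G H G X') × (H G X' ≃G asSGraph G) × (H G X ≃G asSGraph G)
lemma8 G X X' noUniversal isX isX' distinct =
  induced-cong G (λ v _ → H'-total v) (λ v _ → H-total v) , induced-full G H'-total , induced-full G H-total
  where
  H-total : ∀ v → T (inTransversal G X v)
  H-total = inTransversal-total {G = G} noUniversal isX isX' distinct

  H'-total : ∀ v → T (inTransversal G X' v)
  H'-total = inTransversal-total {G = G} noUniversal isX' isX (distinct ∘ SamePartition-sym)
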